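{- There is no distance-regular dicirculant (distance-regular Cayley graph on a dicyclic group $\mathrm{Dic}_n$, $n\ge1$) that is isomorphic to a complete bipartite graph without a $1$-factor, i.e. to $K_{m,m}-mK_2$ for some $m$.
   Context: $\mathrm{Dic}_n=\langle \alpha,\beta \mid \alpha^{2n}=1,\ \beta^2=\alpha^n,\ \beta^{ -1}\alpha\beta=\alpha^{ -1}\rangle$, of order $4n$. For a group $G$ and $S\subseteq G\setminus\{1\}$ with $S=S^{ -1}$, $\mathrm{Cay}(G,S)$ has vertex set $G$, with $g,h$ adjacent iff $g^{ -1}h\in S$. $K_{m,m}-mK_2$ is the complete bipartite graph $K_{m,m}$ with a perfect matching removed. Distance-regular: connected, and for vertices $u,v$ at distance $i$ the numbers of neighbours of $v$ at distance $i-1,i,i+1$ from $u$ depend only on $i$. -}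

module Defs where

open import Level using (0ℓ)
open import Data.Nat using (ℕ; zero; suc; _+_; _*_; _∸_; _<_; NonZero)
open import Data.Nat.Properties using (m*n≢0)
open import Data.Nat.DivMod using (_mod_)
open import Data.Fin using (Fin; toℕ)
open import Data.Bool using (Bool; true; false)
open import Data.Product using (Σ; _×_; _,_; ∃)
open import Relation.Binary.PropositionalEquality using (_≡_; _≢_)
open import Relation.Nullary using (¬_)
open import Function.Bundles using (_↔_; Inverse)

-- The dicyclic group Dic_n = ⟨ α, β | α^{2n} = 1, β² = αⁿ, β⁻¹αβ = α⁻¹ ⟩
-- modelled by its normal form: every element is uniquely α^k β^e with
-- k ∈ ℤ/2n and e ∈ {0,1}.  (exp , false) = α^exp, (exp , true) = α^exp β.

record Dic (n : ℕ) : Set where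
  constructor ⟨_,_⟩
  field
    exp : Fin (2 * n)
    hasβ : Bool

module _ (n : ℕ) .{{_ : NonZero n}} where

  private
    instance
      nz2n : NonZero (2 * n)
      nz2n = m*n≢0 2 n

  md : ℕ → Fin (2 * n)
  md x = x mod (2 * n)

  neg : Fin (2 * n) → Fin (2 * n)
  neg a = md ((2 * n) ∸ toℕ a)

  dic-one : Dic n
  dic-one = ⟨ md 0 , false ⟩

  dic-α : Dic n
  dic-α = ⟨ md 1 , false ⟩

  dic-β : Dic n
  dic-β = ⟨ md 0 , true ⟩

  -- (α^a β^e)(α^c β^f), using β α^c = α^{-c} β and β² = αⁿ
  dic-mul : Dic n → Dic n → Dic n
  dic-mul ⟨ a , false ⟩ ⟨ c , f ⟩     = ⟨ md (toℕ a + toℕ c) , f ⟩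
  dic-mul ⟨ a , true ⟩  ⟨ c , false ⟩ = ⟨ md (toℕ a + toℕ (neg c)) , true ⟩
  dic-mul ⟨ a , true ⟩  ⟨ c , true ⟩  = ⟨ md (toℕ a + toℕ (neg c) + n) , false ⟩

  dic-inv : Dic n → Dic n
  dic-inv ⟨ a , false ⟩ = ⟨ neg a , false ⟩
  dic-inv ⟨ a , true ⟩  = ⟨ md (toℕ a + n) , true ⟩

  CayAdj : (S : Dic n → Set) → Dic n → Dic n → Set
  CayAdj S g h = S (dic-mul (dic-inv g) h)

data Walk {V : Set} (Adj : V → V → Set) : V → V → ℕ → Set where
  here  : ∀ {u} → Walk Adj u u zero
  step  : ∀ {u v w k} → Adj u v → Walk Adj v w k → Walk Adj u w (suc k)

Dist : {V : Set} → (V → V → Set) → V → V → ℕ → Set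
Dist Adj u v i = Walk Adj u v i × (∀ j → j < i → ¬ Walk Adj u v j)

Connected : {V : Set} → (V → V → Set) → Set
Connected {V} Adj = ∀ (u v : V) → ∃ λ i → Walk Adj u v i

HasCard : {V : Set} → (V → Set) → ℕ → Set
HasCard {V} P c = Fin c ↔ Σ V P

NbrCount : {V : Set} → (V → V → Set) → V → V → ℕ → ℕ → Set
NbrCount Adj u v j c = HasCard (λ w → Adj v w × Dist Adj u w j) c

DistanceRegular : {V : Set} → (V → V → Set) → Set
DistanceRegular {V} Adj =
  Connected Adj ×
  (∀ i → ∃ λ c → ∃ λ a → ∃ λ b → ∀ (u v : V) → Dist Adj u v i →
     (1 Data.Nat.≤ i → NbrCount Adj u v (i ∸ 1) c) ×
     NbrCount Adj u v i a ×
     NbrCount Adj u v (suc i) b)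

KmmMinusMatching : (m : ℕ) → Bool × Fin m → Bool × Fin m → Set
KmmMinusMatching m (s , i) (t , j) = s ≢ t × i ≢ j

record GraphIso {V W : Set} (A : V → V → Set) (B : W → W → Set) : Set where
  field
    bij : V ↔ W
  open Inverse bij public
  field
    preserves : ∀ u v → A u v → B (to u) (to v)
    reflects  : ∀ u v → B (to u) (to v) → A u v

{-# OPTIONS --safe #-}
module Submission where

-- K_{2,2} − 2K₂ is disconnected, so let m ≠ 2. Then every vertex of K_{m,m} − mK₂ has a unique
-- antipode (a distinct, non-adjacent vertex without common neighbours): its matching partner.
-- In a Cayley graph left translations are automorphisms, so if z is the antipode of 1 then z·z
-- is the antipode of z, i.e. z² = 1; being ≠ 1, z is the unique involution αⁿ of Dic_n. A
-- connected Cayley graph of Dic_n has a generator s = α^c β, and s² = αⁿ makes s a common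
-- neighbour of 1 and αⁿ, a contradiction.

open import Defs
open import Level using (0ℓ)
open import Function using (_∘_)
open import Data.Empty using (⊥-elim)
open import Data.Sum using (_⊎_; inj₁; inj₂)
open import Data.Product using (_×_; _,_; proj₁; proj₂; ∃-syntax)
open import Data.Bool as Bool using (Bool; true; false; not)
open import Data.Bool.Properties using (not-involutive; not-¬; ¬-not)
open import Data.Nat as ℕ using (ℕ; zero; suc; _∸_; NonZero)
import Data.Nat.Properties as ℕ
import Data.Nat.Divisibility as ℕᵈ
open import Data.Nat.DivMod using (_%_; _/_; _mod_; m%n<n)
open import Data.Integer as ℤ using (ℤ; +_; -_; _+_; _-_; _*_; _⊖_; 0ℤ; 1ℤ)
import Data.Integer.Properties as ℤ
open import Data.Integer.DivMod using (a≡a%ℕn+[a/ℕn]*n)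
open import Data.Integer.Divisibility.Signed using (_∣_; divides; ∣⇒∣ᵤ; ∣m∣n⇒∣m+n; ∣m⇒∣-m)
open import Data.Integer.Tactic.RingSolver using (solve-∀)
open import Data.Fin as Fin using (Fin; zero; suc; toℕ)
open import Data.Fin.Properties using (toℕ-fromℕ<; toℕ<n; toℕ-injective)
open import Algebra.Bundles using (Group)
open import Algebra.Structures using (IsGroup)
import Algebra.Properties.Group as GroupProperties
open import Relation.Nullary using (¬_; contradiction; yes; no)
open import Relation.Binary.PropositionalEquality hiding ([_])

module ModularArithmetic (d : ℕ) .{{_ : NonZero d}} where

  infix 4 _≈_
  record _≈_ (x y : ℤ) : Set where
    constructor by-multiple
    field d∣x-y : + d ∣ x - y

  ≈-reflexive : ∀ {x y} → x ≡ y → x ≈ y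
  ≈-reflexive {x} refl = by-multiple (divides 0ℤ (ℤ.+-inverseʳ x))

  ≈-refl : ∀ {x} → x ≈ x
  ≈-refl = ≈-reflexive refl

  ≈-sym : ∀ {x y} → x ≈ y → y ≈ x
  ≈-sym {x} {y} (by-multiple p) = by-multiple (subst (+ d ∣_) (lemma x y) (∣m⇒∣-m p))
    where
    lemma : ∀ x y → - (x - y) ≡ y - x
    lemma = solve-∀

  ≈-trans : ∀ {x y z} → x ≈ y → y ≈ z → x ≈ z
  ≈-trans {x} {y} {z} (by-multiple p) (by-multiple q) =
    by-multiple (subst (+ d ∣_) (lemma x y z) (∣m∣n⇒∣m+n p q))
    where
    lemma : ∀ x y z → (x - y) + (y - z) ≡ x - z
    lemma = solve-∀

  +-cong : ∀ {x y u v} → x ≈ y → u ≈ v → x + u ≈ y + v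
  +-cong {x} {y} {u} {v} (by-multiple p) (by-multiple q) =
    by-multiple (subst (+ d ∣_) (lemma x y u v) (∣m∣n⇒∣m+n p q))
    where
    lemma : ∀ x y u v → (x - y) + (u - v) ≡ (x + u) - (y + v)
    lemma = solve-∀

  ⊖-cong : ∀ {x y} → x ≈ y → - x ≈ - y
  ⊖-cong {x} {y} (by-multiple p) = by-multiple (subst (+ d ∣_) (lemma x y) (∣m⇒∣-m p))
    where
    lemma : ∀ x y → - (x - y) ≡ - x - - y
    lemma = solve-∀

  ι : Fin d → ℤ
  ι a = + toℕ a

  ι-mod : ∀ x → ι (x mod d) ≈ + x
  ι-mod x = by-multiple (divides (- (+ (x / d))) (begin
      ι (x mod d) - + x
    ≡⟨ cong₂ _-_ (cong +_ (toℕ-fromℕ< (m%n<n x d))) (a≡a%ℕn+[a/ℕn]*n (+ x) d) ⟩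
      + (x % d) - (+ (x % d) + + (x / d) * + d)
    ≡⟨ lemma (+ (x % d)) (+ (x / d)) (+ d) ⟩
      - (+ (x / d)) * + d
    ∎))
    where
    open ≡-Reasoning
    lemma : ∀ r q d → r - (r + q * d) ≡ - q * d
    lemma = solve-∀

  ι-complement : ∀ a → ι ((d ∸ toℕ a) mod d) ≈ - ι a
  ι-complement a = ≈-trans (ι-mod (d ∸ toℕ a)) (by-multiple (divides 1ℤ (begin
      + (d ∸ toℕ a) - - ι a       ≡⟨ cong (_+_ (+ (d ∸ toℕ a))) (ℤ.neg-involutive (ι a)) ⟩
      + (d ∸ toℕ a ℕ.+ toℕ a)     ≡⟨ cong +_ (ℕ.m∸n+n≡m (ℕ.<⇒≤ (toℕ<n a))) ⟩
      + d                         ≡⟨ ℤ.*-identityˡ (+ d) ⟨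
      1ℤ * + d                    ∎)))
    where open ≡-Reasoning

  ι-injective : ∀ {a b} → ι a ≈ ι b → a ≡ b
  ι-injective {a} {b} (by-multiple d∣a-b) =
    toℕ-injective (ℤ.+-injective (ℤ.i-j≡0⇒i≡j (ι a) (ι b) (ℤ.∣i∣≡0⇒i≡0 ∣a-b∣≡0)))
    where
    ∣a-b∣<d : ℤ.∣ ι a - ι b ∣ ℕ.< d
    ∣a-b∣<d = begin-strict
      ℤ.∣ ι a - ι b ∣        ≡⟨ cong ℤ.∣_∣ (ℤ.m-n≡m⊖n (toℕ a) (toℕ b)) ⟩
      ℤ.∣ toℕ a ⊖ toℕ b ∣    ≤⟨ ℤ.∣m⊝n∣≤m⊔n (toℕ a) (toℕ b) ⟩
      toℕ a ℕ.⊔ toℕ b        <⟨ ℕ.⊔-lub (toℕ<n a) (toℕ<n b) ⟩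
      d                      ∎
      where open ℕ.≤-Reasoning
    ∣a-b∣≡0 : ℤ.∣ ι a - ι b ∣ ≡ 0
    ∣a-b∣≡0 with ℤ.∣ ι a - ι b ∣ | ∣⇒∣ᵤ d∣a-b | ∣a-b∣<d
    ... | zero  | _   | _   = refl
    ... | suc _ | d∣k | k<d = contradiction d∣k (ℕᵈ.>⇒∤ k<d)

  ≈0⇒∣ : ∀ {x} → + x ≈ 0ℤ → d ℕᵈ.∣ x
  ≈0⇒∣ {x} (by-multiple d∣x-0) = ∣⇒∣ᵤ (subst (+ d ∣_) (ℤ.+-identityʳ (+ x)) d∣x-0)

2n∣a+a⇒a≡0⊎a≡n : ∀ {a n} → a ℕ.< 2 ℕ.* n → 2 ℕ.* n ℕᵈ.∣ a ℕ.+ a → a ≡ 0 ⊎ a ≡ n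
2n∣a+a⇒a≡0⊎a≡n {a} {n} a<2n 2n∣a+a
  with ℕᵈ.*-cancelˡ-∣ 2 (subst (2 ℕ.* n ℕᵈ.∣_) (cong (a ℕ.+_) (sym (ℕ.+-identityʳ a))) 2n∣a+a)
... | ℕᵈ.divides 0 a≡0             = inj₁ a≡0
... | ℕᵈ.divides 1 a≡n+0           = inj₂ (trans a≡n+0 (ℕ.+-identityʳ n))
... | ℕᵈ.divides (suc (suc q)) a≡qn =
  contradiction (subst (2 ℕ.* n ℕ.≤_) (sym a≡qn) (ℕ.*-monoˡ-≤ n (ℕ.s≤s (ℕ.s≤s (ℕ.z≤n {q})))))
                (ℕ.<⇒≱ a<2n)

module DicyclicGroup (n : ℕ) .{{_ : NonZero n}} where

  private
    instance
      2n≢0 : NonZero (2 ℕ.* n)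
      2n≢0 = ℕ.m*n≢0 2 n

  open ModularArithmetic (2 ℕ.* n)

  infixl 7 _·_
  _·_ : Dic n → Dic n → Dic n
  _·_ = dic-mul n

  -- Each law
  -- below reads off integer representatives of both sides by a proof tree mirroring the
  -- expression (atoms are explicit so that the representative is inferred) and compares them
  -- with the ring solver.
  [_] : ∀ a → ι a ≈ ι a
  [ _ ] = ≈-refl

  [_]ℕ : ∀ x → + x ≈ + x
  [ _ ]ℕ = ≈-refl

  infixl 6 _⊕_
  _⊕_ : ∀ {x y e f} → + x ≈ e → + y ≈ f → + (x ℕ.+ y) ≈ e + f
  _⊕_ = +-cong

  md-≈ : ∀ {x e} → + x ≈ e → ι (md n x) ≈ e
  md-≈ = ≈-trans (ι-mod _)

  neg-≈ : ∀ {a e} → ι a ≈ e → ι (neg n a) ≈ - e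
  neg-≈ p = ≈-trans (ι-complement _) (⊖-cong p)

  ≡+2n⇒≈ : ∀ {e f} → e ≡ f + (+ n + + n) → e ≈ f
  ≡+2n⇒≈ {e} {f} e≡f+2n = by-multiple (divides 1ℤ (begin
      e - f                     ≡⟨ cong (_- f) e≡f+2n ⟩
      f + (+ n + + n) - f       ≡⟨ lemma f (+ n) ⟩
      1ℤ * (+ n + + n)          ≡⟨ cong (λ k → 1ℤ * + (n ℕ.+ k)) (ℕ.+-identityʳ n) ⟨
      1ℤ * + (2 ℕ.* n)          ∎))
    where
    open ≡-Reasoning
    lemma : ∀ f n → f + (n + n) - f ≡ 1ℤ * (n + n)
    lemma = solve-∀

  exp-≡ : ∀ {a b e f} → ι a ≈ e → ι b ≈ f → e ≈ f → a ≡ b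
  exp-≡ a≈e b≈f e≈f = ι-injective (≈-trans a≈e (≈-trans e≈f (≈-sym b≈f)))

  dic-αⁿ : Dic n
  dic-αⁿ = ⟨ md n n , false ⟩

  dic-assoc : ∀ x y z → (x · y) · z ≡ x · (y · z)
  dic-assoc ⟨ a , false ⟩ ⟨ b , false ⟩ ⟨ c , g ⟩ = cong ⟨_, g ⟩ (exp-≡
    (md-≈ (md-≈ ([ a ] ⊕ [ b ]) ⊕ [ c ]))
    (md-≈ ([ a ] ⊕ md-≈ ([ b ] ⊕ [ c ])))
    (≈-reflexive (ℤ.+-assoc (ι a) (ι b) (ι c))))
  dic-assoc ⟨ a , false ⟩ ⟨ b , true ⟩ ⟨ c , false ⟩ = cong ⟨_, true ⟩ (exp-≡
    (md-≈ (md-≈ ([ a ] ⊕ [ b ]) ⊕ neg-≈ [ c ]))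
    (md-≈ ([ a ] ⊕ md-≈ ([ b ] ⊕ neg-≈ [ c ])))
    (≈-reflexive (ℤ.+-assoc (ι a) (ι b) (- ι c))))
  dic-assoc ⟨ a , false ⟩ ⟨ b , true ⟩ ⟨ c , true ⟩ = cong ⟨_, false ⟩ (exp-≡
    (md-≈ (md-≈ ([ a ] ⊕ [ b ]) ⊕ neg-≈ [ c ] ⊕ [ n ]ℕ))
    (md-≈ ([ a ] ⊕ md-≈ ([ b ] ⊕ neg-≈ [ c ] ⊕ [ n ]ℕ)))
    (≈-reflexive (lemma (ι a) (ι b) (ι c) (+ n))))
    where
    lemma : ∀ a b c n → a + b - c + n ≡ a + (b - c + n)
    lemma = solve-∀
  dic-assoc ⟨ a , true ⟩ ⟨ b , false ⟩ ⟨ c , false ⟩ = cong ⟨_, true ⟩ (exp-≡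
    (md-≈ (md-≈ ([ a ] ⊕ neg-≈ [ b ]) ⊕ neg-≈ [ c ]))
    (md-≈ ([ a ] ⊕ neg-≈ (md-≈ ([ b ] ⊕ [ c ]))))
    (≈-reflexive (lemma (ι a) (ι b) (ι c))))
    where
    lemma : ∀ a b c → a - b - c ≡ a - (b + c)
    lemma = solve-∀
  dic-assoc ⟨ a , true ⟩ ⟨ b , false ⟩ ⟨ c , true ⟩ = cong ⟨_, false ⟩ (exp-≡
    (md-≈ (md-≈ ([ a ] ⊕ neg-≈ [ b ]) ⊕ neg-≈ [ c ] ⊕ [ n ]ℕ))
    (md-≈ ([ a ] ⊕ neg-≈ (md-≈ ([ b ] ⊕ [ c ])) ⊕ [ n ]ℕ))
    (≈-reflexive (lemma (ι a) (ι b) (ι c) (+ n))))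
    where
    lemma : ∀ a b c n → a - b - c + n ≡ a - (b + c) + n
    lemma = solve-∀
  dic-assoc ⟨ a , true ⟩ ⟨ b , true ⟩ ⟨ c , false ⟩ = cong ⟨_, false ⟩ (exp-≡
    (md-≈ (md-≈ ([ a ] ⊕ neg-≈ [ b ] ⊕ [ n ]ℕ) ⊕ [ c ]))
    (md-≈ ([ a ] ⊕ neg-≈ (md-≈ ([ b ] ⊕ neg-≈ [ c ])) ⊕ [ n ]ℕ))
    (≈-reflexive (lemma (ι a) (ι b) (ι c) (+ n))))
    where
    lemma : ∀ a b c n → a - b + n + c ≡ a - (b - c) + n
    lemma = solve-∀
  dic-assoc ⟨ a , true ⟩ ⟨ b , true ⟩ ⟨ c , true ⟩ = cong ⟨_, true ⟩ (exp-≡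
    (md-≈ (md-≈ ([ a ] ⊕ neg-≈ [ b ] ⊕ [ n ]ℕ) ⊕ [ c ]))
    (md-≈ ([ a ] ⊕ neg-≈ (md-≈ ([ b ] ⊕ neg-≈ [ c ] ⊕ [ n ]ℕ))))
    (≡+2n⇒≈ (lemma (ι a) (ι b) (ι c) (+ n))))
    where
    lemma : ∀ a b c n → a - b + n + c ≡ a - (b - c + n) + (n + n)
    lemma = solve-∀

  dic-identityˡ : ∀ x → dic-one n · x ≡ x
  dic-identityˡ ⟨ c , g ⟩ = cong ⟨_, g ⟩ (exp-≡
    (md-≈ (md-≈ [ 0 ]ℕ ⊕ [ c ]))
    [ c ]
    (≈-reflexive (ℤ.+-identityˡ (ι c))))

  dic-identityʳ : ∀ x → x · dic-one n ≡ x
  dic-identityʳ ⟨ a , false ⟩ = cong ⟨_, false ⟩ (exp-≡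
    (md-≈ ([ a ] ⊕ md-≈ [ 0 ]ℕ))
    [ a ]
    (≈-reflexive (ℤ.+-identityʳ (ι a))))
  dic-identityʳ ⟨ a , true ⟩ = cong ⟨_, true ⟩ (exp-≡
    (md-≈ ([ a ] ⊕ neg-≈ (md-≈ [ 0 ]ℕ)))
    [ a ]
    (≈-reflexive (ℤ.+-identityʳ (ι a))))

  dic-inverseˡ : ∀ x → dic-inv n x · x ≡ dic-one n
  dic-inverseˡ ⟨ a , false ⟩ = cong ⟨_, false ⟩ (exp-≡
    (md-≈ (neg-≈ [ a ] ⊕ [ a ]))
    (md-≈ [ 0 ]ℕ)
    (≈-reflexive (ℤ.+-inverseˡ (ι a))))
  dic-inverseˡ ⟨ a , true ⟩ = cong ⟨_, false ⟩ (exp-≡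
    (md-≈ (md-≈ ([ a ] ⊕ [ n ]ℕ) ⊕ neg-≈ [ a ] ⊕ [ n ]ℕ))
    (md-≈ [ 0 ]ℕ)
    (≡+2n⇒≈ (lemma (ι a) (+ n))))
    where
    lemma : ∀ a n → a + n - a + n ≡ + 0 + (n + n)
    lemma = solve-∀

  dic-inverseʳ : ∀ x → x · dic-inv n x ≡ dic-one n
  dic-inverseʳ ⟨ a , false ⟩ = cong ⟨_, false ⟩ (exp-≡
    (md-≈ ([ a ] ⊕ neg-≈ [ a ]))
    (md-≈ [ 0 ]ℕ)
    (≈-reflexive (ℤ.+-inverseʳ (ι a))))
  dic-inverseʳ ⟨ a , true ⟩ = cong ⟨_, false ⟩ (exp-≡
    (md-≈ ([ a ] ⊕ neg-≈ (md-≈ ([ a ] ⊕ [ n ]ℕ)) ⊕ [ n ]ℕ))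
    (md-≈ [ 0 ]ℕ)
    (≈-reflexive (lemma (ι a) (+ n))))
    where
    lemma : ∀ a n → a - (a + n) + n ≡ + 0
    lemma = solve-∀

  dic-isGroup : IsGroup _≡_ (dic-mul n) (dic-one n) (dic-inv n)
  dic-isGroup = record
    { isMonoid = record
      { isSemigroup = record
        { isMagma = record { isEquivalence = isEquivalence ; ∙-cong = cong₂ _·_ }
        ; assoc   = dic-assoc
        }
      ; identity = dic-identityˡ , dic-identityʳ
      }
    ; inverse = dic-inverseˡ , dic-inverseʳ
    ; ⁻¹-cong = cong (dic-inv n)
    }

  dic-β-square : ∀ c → ⟨ c , true ⟩ · ⟨ c , true ⟩ ≡ dic-αⁿ
  dic-β-square c = cong ⟨_, false ⟩ (exp-≡
    (md-≈ ([ c ] ⊕ neg-≈ [ c ] ⊕ [ n ]ℕ))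
    (md-≈ [ n ]ℕ)
    (≈-reflexive (lemma (ι c) (+ n))))
    where
    lemma : ∀ c n → c - c + n ≡ n
    lemma = solve-∀

  md≡⇒≈ : ∀ {x y} → md n x ≡ md n y → + x ≈ + y
  md≡⇒≈ {x} {y} eq = ≈-trans (≈-sym (ι-mod x)) (≈-trans (≈-reflexive (cong ι eq)) (ι-mod y))

  αⁿ≢one : dic-αⁿ ≢ dic-one n
  αⁿ≢one αⁿ≡one = ℕ.<⇒≱ n<2n (ℕᵈ.∣⇒≤ (≈0⇒∣ (md≡⇒≈ (cong Dic.exp αⁿ≡one))))
    where
    n<2n : n ℕ.< 2 ℕ.* n
    n<2n = subst (n ℕ.<_) (ℕ.*-comm n 2) (ℕ.m<m*n n 2 (ℕ.s≤s (ℕ.s≤s ℕ.z≤n)))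

  square≡one⇒αⁿ : ∀ x → x · x ≡ dic-one n → x ≢ dic-one n → x ≡ dic-αⁿ
  square≡one⇒αⁿ ⟨ c , true ⟩ x²≡one _ = ⊥-elim (αⁿ≢one (trans (sym (dic-β-square c)) x²≡one))
  square≡one⇒αⁿ ⟨ a , false ⟩ x²≡one x≢one
    with 2n∣a+a⇒a≡0⊎a≡n (toℕ<n a) (≈0⇒∣ (md≡⇒≈ (cong Dic.exp x²≡one)))
  ... | inj₁ a≡0 = ⊥-elim (x≢one (cong ⟨_, false ⟩ (exp-≡ (≈-reflexive (cong +_ a≡0)) (md-≈ [ 0 ]ℕ) ≈-refl)))
  ... | inj₂ a≡n = cong ⟨_, false ⟩ (exp-≡ (≈-reflexive (cong +_ a≡n)) (md-≈ [ n ]ℕ) ≈-refl)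

invariant-along-walk : ∀ {V X : Set} {Adj : V → V → Set} (f : V → X) →
                       (∀ {u v} → Adj u v → f u ≡ f v) →
                       ∀ {u v k} → Walk Adj u v k → f u ≡ f v
invariant-along-walk f f-edge here       = refl
invariant-along-walk f f-edge (step a w) = trans (f-edge a) (invariant-along-walk f f-edge w)

Antipodal : {V : Set} → (V → V → Set) → V → V → Set
Antipodal Adj u v = u ≢ v × ¬ Adj u v × (∀ w → ¬ (Adj u w × Adj v w))

module _ {V W : Set} {A : V → V → Set} {B : W → W → Set} (iso : GraphIso A B) where
  open GraphIso iso

  iso-preserves-walk : ∀ {u v k} → Walk A u v k → Walk B (to u) (to v) k
  iso-preserves-walk here       = here
  iso-preserves-walk (step a w) = step (preserves _ _ a) (iso-preserves-walk w)

  iso-preserves-connected : Connected A → Connected B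
  iso-preserves-connected connected x y =
    let k , w = connected (from x) (from y)
    in  k , subst₂ (λ x y → Walk B x y k) (strictlyInverseˡ x) (strictlyInverseˡ y)
                   (iso-preserves-walk w)

  private
    reflects-to : ∀ {u y} → B (to u) y → A u (from y)
    reflects-to {u} {y} b = reflects u (from y) (subst (B (to u)) (sym (strictlyInverseˡ y)) b)

    preserves-from : ∀ {x v} → A (from x) v → B x (to v)
    preserves-from {x} {v} a = subst (λ x → B x (to v)) (strictlyInverseˡ x) (preserves _ _ a)

  iso-preserves-antipodal : ∀ {u v} → Antipodal A u v → Antipodal B (to u) (to v)
  iso-preserves-antipodal {u} {v} (u≢v , ¬uv , ¬common) =
      (λ tu≡tv → u≢v (trans (sym (strictlyInverseʳ u))
                            (trans (cong from tu≡tv) (strictlyInverseʳ v))))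
    , (λ b → ¬uv (reflects u v b))
    , (λ y (b₁ , b₂) → ¬common (from y) (reflects-to b₁ , reflects-to b₂))

  iso-reflects-antipodal : ∀ {x y} → Antipodal B x y → Antipodal A (from x) (from y)
  iso-reflects-antipodal {x} {y} (x≢y , ¬xy , ¬common) =
      (λ fx≡fy → x≢y (trans (sym (strictlyInverseˡ x))
                            (trans (cong to fx≡fy) (strictlyInverseˡ y))))
    , (λ a → ¬xy (subst (B x) (strictlyInverseˡ y) (preserves-from a)))
    , (λ w (a₁ , a₂) → ¬common (to w) (preserves-from a₁ , preserves-from a₂))

flip : ∀ {m} → Bool × Fin m → Bool × Fin m
flip (b , i) = not b , i

flip-involutive : ∀ {m} (v : Bool × Fin m) → flip (flip v) ≡ v
flip-involutive (b , i) = cong (_, i) (not-involutive b)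

flip-antipodal : ∀ {m} (v : Bool × Fin m) → Antipodal (KmmMinusMatching m) v (flip v)
flip-antipodal (b , i) =
    (λ v≡flip-v → not-¬ refl (cong proj₁ v≡flip-v))
  , (λ (_ , i≢i) → i≢i refl)
  , (λ (c , _) ((b≢c , _) , (not-b≢c , _)) → not-b≢c (sym (¬-not (λ c≡b → b≢c (sym c≡b)))))

third-index : ∀ {m} → m ≢ 2 → (i j : Fin m) → i ≢ j → ∃[ k ] i ≢ k × j ≢ k
third-index {1} _ zero zero i≢j = ⊥-elim (i≢j refl)
third-index {2} m≢2 _ _ _ = ⊥-elim (m≢2 refl)
third-index {suc (suc (suc _))} _ zero zero i≢j = ⊥-elim (i≢j refl)
third-index {suc (suc (suc _))} _ zero (suc zero) _ = suc (suc zero) , (λ ()) , (λ ())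
third-index {suc (suc (suc _))} _ zero (suc (suc _)) _ = suc zero , (λ ()) , (λ ())
third-index {suc (suc (suc _))} _ (suc zero) zero _ = suc (suc zero) , (λ ()) , (λ ())
third-index {suc (suc (suc _))} _ (suc (suc _)) zero _ = suc zero , (λ ()) , (λ ())
third-index {suc (suc (suc _))} _ (suc _) (suc _) _ = zero , (λ ()) , (λ ())

antipodal⇒flip : ∀ {m} → m ≢ 2 → ∀ u v → Antipodal (KmmMinusMatching m) u v → v ≡ flip u
antipodal⇒flip m≢2 (b , i) (c , j) (u≢v , ¬uv , ¬common) with b Bool.≟ c | i Fin.≟ j
... | yes refl | yes refl = ⊥-elim (u≢v refl)
... | yes refl | no i≢j   =
  let k , i≢k , j≢k = third-index m≢2 i j i≢j
  in  ⊥-elim (¬common (not b , k) ((not-¬ refl , i≢k) , (not-¬ refl , j≢k)))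
... | no b≢c   | yes refl = cong (_, i) (¬-not (λ c≡b → b≢c (sym c≡b)))
... | no b≢c   | no i≢j   = ⊥-elim (¬uv (b≢c , i≢j))

K₂₂-disconnected : ¬ Connected (KmmMinusMatching 2)
K₂₂-disconnected connected =
  not-¬ refl (invariant-along-walk parity parity-edge (proj₂ (connected (false , zero) (false , suc zero))))
  where
  parity : Bool × Fin 2 → Bool
  parity (b , zero)     = b
  parity (b , suc zero) = not b

  parity-edge : ∀ {u v} → KmmMinusMatching 2 u v → parity u ≡ parity v
  parity-edge {_ , zero}     {_ , zero}     (_ , i≢j) = ⊥-elim (i≢j refl)
  parity-edge {_ , suc zero} {_ , suc zero} (_ , i≢j) = ⊥-elim (i≢j refl)
  parity-edge {_ , zero}     {_ , suc zero} (b≢c , _) = ¬-not b≢c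
  parity-edge {_ , suc zero} {_ , zero}     (b≢c , _) = sym (¬-not (λ c≡b → b≢c (sym c≡b)))

module Antipodes {V : Set} {A : V → V → Set} {m : ℕ} (iso : GraphIso A (KmmMinusMatching m)) where
  open GraphIso iso

  antipode : V → V
  antipode u = from (flip (to u))

  antipode-involutive : ∀ u → antipode (antipode u) ≡ u
  antipode-involutive u = begin
    from (flip (to (from (flip (to u)))))  ≡⟨ cong (from ∘ flip) (strictlyInverseˡ _) ⟩
    from (flip (flip (to u)))              ≡⟨ cong from (flip-involutive (to u)) ⟩
    from (to u)                            ≡⟨ strictlyInverseʳ u ⟩
    u                                      ∎
    where open ≡-Reasoning

  antipode-antipodal : ∀ u → Antipodal A u (antipode u)
  antipode-antipodal u = subst (λ w → Antipodal A w (antipode u)) (strictlyInverseʳ u)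
                               (iso-reflects-antipodal iso (flip-antipodal (to u)))

  antipodal⇒antipode : m ≢ 2 → ∀ {u v} → Antipodal A u v → v ≡ antipode u
  antipodal⇒antipode m≢2 {u} {v} u-v-antipodal = begin
    v              ≡⟨ strictlyInverseʳ v ⟨
    from (to v)    ≡⟨ cong from (antipodal⇒flip m≢2 _ _ (iso-preserves-antipodal iso u-v-antipodal)) ⟩
    antipode u     ∎
    where open ≡-Reasoning

module CayleyGraph {G : Set} {mul : G → G → G} {ε : G} {inv : G → G}
                   (isGroup : IsGroup _≡_ mul ε inv) (S : G → Set) where

  group : Group 0ℓ 0ℓ
  group = record { isGroup = isGroup }

  open Group group using (_∙_; _⁻¹; _\\_; assoc)
  open GroupProperties group
    using (\\-leftDividesˡ; \\-leftDividesʳ; ∙-cancelˡ; ⁻¹-anti-homo-∙; ⁻¹-anti-homo-\\)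

  Cay : G → G → Set
  Cay x y = S (x \\ y)

  Cay-step : ∀ x {s} → S s → Cay x (x ∙ s)
  Cay-step x {s} s∈S = subst S (sym (\\-leftDividesʳ x s)) s∈S

  Cay-sym : (∀ g → S g → S (g ⁻¹)) → ∀ {x y} → Cay x y → Cay y x
  Cay-sym S-sym {x} {y} xy = subst S (⁻¹-anti-homo-\\ x y) (S-sym _ xy)

  \\-translate : ∀ g x y → (g ∙ x) \\ (g ∙ y) ≡ x \\ y
  \\-translate g x y = begin
    (g ∙ x) ⁻¹ ∙ (g ∙ y)       ≡⟨ cong (_∙ (g ∙ y)) (⁻¹-anti-homo-∙ g x) ⟩
    (x ⁻¹ ∙ g ⁻¹) ∙ (g ∙ y)    ≡⟨ assoc (x ⁻¹) (g ⁻¹) (g ∙ y) ⟩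
    x ⁻¹ ∙ (g ⁻¹ ∙ (g ∙ y))    ≡⟨ cong (x ⁻¹ ∙_) (\\-leftDividesʳ g y) ⟩
    x ⁻¹ ∙ y                   ∎
    where open ≡-Reasoning

  antipodal-translate : ∀ g {x y} → Antipodal Cay x y → Antipodal Cay (g ∙ x) (g ∙ y)
  antipodal-translate g {x} {y} (x≢y , ¬xy , ¬common) =
      (λ gx≡gy → x≢y (∙-cancelˡ g x y gx≡gy))
    , (λ gx-gy → ¬xy (subst S (\\-translate g x y) gx-gy))
    , (λ w (gx-w , gy-w) → ¬common (g \\ w) (untranslate gx-w , untranslate gy-w))
    where
    untranslate : ∀ {u w} → Cay (g ∙ u) w → Cay u (g \\ w)
    untranslate {u} {w} gu-w = subst S (\\-translate g u (g \\ w))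
                                 (subst (Cay (g ∙ u)) (sym (\\-leftDividesˡ g w)) gu-w)

module Dicirculant (n : ℕ) .{{_ : NonZero n}} (S : Dic n → Set) where

  open DicyclicGroup n
  open CayleyGraph dic-isGroup S

  β-free⇒disconnected : (∀ c → ¬ S ⟨ c , true ⟩) → ¬ Connected (CayAdj n S)
  β-free⇒disconnected β-free connected =
    contradiction (invariant-along-walk Dic.hasβ β-free-edge (proj₂ (connected (dic-one n) (dic-β n))))
                  (λ ())
    where
    β-free-edge : ∀ {x y} → CayAdj n S x y → Dic.hasβ x ≡ Dic.hasβ y
    β-free-edge {⟨ _ , false ⟩} {⟨ _ , false ⟩} _   = refl
    β-free-edge {⟨ _ , false ⟩} {⟨ _ , true ⟩}  x-y = ⊥-elim (β-free _ x-y)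
    β-free-edge {⟨ _ , true ⟩}  {⟨ _ , false ⟩} x-y = ⊥-elim (β-free _ x-y)
    β-free-edge {⟨ _ , true ⟩}  {⟨ _ , true ⟩}  _   = refl

  no-β-generator : (∀ g → S g → S (dic-inv n g)) → ∀ {m} →
                   GraphIso (CayAdj n S) (KmmMinusMatching m) → m ≢ 2 → ∀ c → ¬ S ⟨ c , true ⟩
  no-β-generator S-sym iso m≢2 c s∈S = ¬common s (one-s , Cay-sym S-sym {s} {dic-αⁿ} s-αⁿ)
    where
    open Antipodes iso
    one = dic-one n
    s = ⟨ c , true ⟩
    z = antipode one

    z²≡one : z · z ≡ one
    z²≡one = begin
      z · z        ≡⟨ antipodal⇒antipode m≢2 (subst (λ w → Antipodal Cay w (z · z)) (dic-identityʳ z)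
                                                     (antipodal-translate z (antipode-antipodal one))) ⟩
      antipode z   ≡⟨ antipode-involutive one ⟩
      one          ∎
      where open ≡-Reasoning

    z≡αⁿ : z ≡ dic-αⁿ
    z≡αⁿ = square≡one⇒αⁿ z z²≡one (λ z≡one → proj₁ (antipode-antipodal one) (sym z≡one))

    ¬common : ∀ w → ¬ (Cay one w × Cay dic-αⁿ w)
    ¬common = proj₂ (proj₂ (subst (Antipodal Cay one) z≡αⁿ (antipode-antipodal one)))

    one-s : Cay one s
    one-s = subst (Cay one) (dic-identityˡ s) (Cay-step one s∈S)

    s-αⁿ : Cay s dic-αⁿ
    s-αⁿ = subst (Cay s) (dic-β-square c) (Cay-step s s∈S)

lemma3p6 : (n : ℕ) → .{{_ : NonZero n}} → (S : Dic n → Set) →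
           ¬ S (dic-one n) → (∀ g → S g → S (dic-inv n g)) →
           DistanceRegular (CayAdj n S) →
           (m : ℕ) → ¬ GraphIso (CayAdj n S) (KmmMinusMatching m)
lemma3p6 n S _ S-sym (connected , _) m iso with m ℕ.≟ 2
... | yes refl = K₂₂-disconnected (iso-preserves-connected iso connected)
... | no m≢2   = β-free⇒disconnected (no-β-generator S-sym iso m≢2) connected
  where open Dicirculant n S
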